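{- Let $k\ge 6$ be an integer and $q$ a prime power, and let $t=\lfloor (k+2)/4\rfloor$. Then any two vertices lying in the same connected component of $D(k,q)$ have the same invariant vector $\vec{a}$.
   Context: $D(k,q)$ is the bipartite graph whose vertex set is the disjoint union of the set of points $(p)=(p_1,\ldots,p_k)\in\mathbb{F}_q^k$ and the set of lines $[l]=[l_1,\ldots,l_k]\in\mathbb{F}_q^k$, where $(p)$ and $[l]$ are adjacent iff $p_i+l_i=f_i$ for all $2\le i\le k$, with $f_2=p_1l_1$, $f_3=p_1l_2$, and for $4\le i\le k$: $f_i=p_{i-2}l_1$ if $i\equiv 0,1\pmod 4$, and $f_i=p_1l_{i-2}$ if $i\equiv 2,3\pmod 4$. For $2\le r\le t$ define $a_r$ on points by $a_2((p))=-p_1p_4+p_2^2+p_5-p_6$ and, for $r\ge 3$, $a_r((p))=(-1)^{r-1}\big[p_1p_{4r-4}-p_2p_{4r-6}-p_2p_{4r-7}+p_3p_{4r-8}-p_{4r-3}+p_{4r-2}+\sum_{i=2}^{r-2}(-p_{4i-3}p_{4(r-i)-2}+p_{4i-1}p_{4(r-i)-4})\big]$; and on lines by $a_2([l])=-l_1l_3+l_2^2-l_5+l_6$ and, for $r\ge 3$, $a_r([l])=(-1)^{r-1}\big[l_1l_{4r-5}-l_2l_{4r-6}-l_2l_{4r-7}+l_3l_{4r-8}+l_{4r-3}-l_{4r-2}+\sum_{i=2}^{r-2}(-l_{4i-3}l_{4(r-i)-2}+l_{4i-1}l_{4(r-i)-4})\big]$. The invariant vector of a vertex $u$ is $\vec{a}(u)=\langle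 a_2(u),a_3(u),\ldots,a_t(u)\rangle\in\mathbb{F}_q^{t-1}$. -}

module Defs where

open import Level using (Level; _⊔_; suc; Lift)
open import Data.Empty using (⊥)
open import Data.Nat as ℕ using (ℕ; zero; suc; _≤_; _∸_; _/_; _%_; _≟_)
open import Data.Nat.Primality using (Prime)
open import Data.Fin using (Fin; fromℕ<)
open import Data.Nat.Properties using (_<?_)
open import Data.List using (List; foldr; map; upTo)
open import Data.Product using (Σ; ∃; _×_; _,_)
open import Data.Sum using (_⊎_; inj₁; inj₂)
open import Relation.Nullary using (¬_; yes; no)
open import Relation.Binary.PropositionalEquality as ≡ using (_≡_)
open import Relation.Binary.Construct.Closure.ReflexiveTransitive using (Star)
open import Algebra.Bundles using (CommutativeRing)
open import Function.Bundles using (Inverse)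

IsPrimePower : ℕ → Set
IsPrimePower q = Σ ℕ λ p → Σ ℕ λ n → Prime p × (1 ≤ n) × (q ≡ p ℕ.^ n)

record FiniteField (c ℓ : Level) (q : ℕ) : Set (Level.suc (c ⊔ ℓ)) where
  field
    commRing : CommutativeRing c ℓ
  open CommutativeRing commRing public
  field
    1≉0      : ¬ (1# ≈ 0#)
    inverse  : ∀ x → ¬ (x ≈ 0#) → Σ Carrier λ y → x * y ≈ 1#
    card     : Inverse setoid (≡.setoid (Fin q))

module DGraph {c ℓ : Level} {q : ℕ} (F : FiniteField c ℓ q) (k : ℕ) where
  open FiniteField F

  -- points and lines are both elements of F_q^k, coordinates indexed 1..k
  Coords : Set c
  Coords = Fin k → Carrier

  -- 1-based coordinate access; 0 outside the range 1..k (never used in range)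
  at : Coords → ℕ → Carrier
  at v zero = 0#
  at v (suc j) with j <? k
  ... | yes j<k = v (fromℕ< j<k)
  ... | no _    = 0#

  f : Coords → Coords → ℕ → Carrier
  f p l i with i
  ... | 2 = at p 1 * at l 1
  ... | 3 = at p 1 * at l 2
  ... | _ with i % 4
  ...   | 0 = at p (i ∸ 2) * at l 1
  ...   | 1 = at p (i ∸ 2) * at l 1
  ...   | _ = at p 1 * at l (i ∸ 2)

  Incident : Coords → Coords → Set ℓ
  Incident p l = ∀ i → 2 ≤ i → i ≤ k → at p i + at l i ≈ f p l i

  -- vertices: inj₁ = point, inj₂ = line
  Vertex : Set c
  Vertex = Coords ⊎ Coords

  Adj : Vertex → Vertex → Set ℓ
  Adj (inj₁ p) (inj₂ l) = Incident p l
  Adj (inj₂ l) (inj₁ p) = Incident p l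
  Adj _        _        = Lift ℓ ⊥

  SameComponent : Vertex → Vertex → Set (c ⊔ ℓ)
  SameComponent = Star Adj

  negPow : ℕ → Carrier → Carrier
  negPow zero x = x
  negPow (suc n) x = - negPow n x

  -- Σ_{i=2}^{n} g i  (empty if n < 2)
  sum2 : ℕ → (ℕ → Carrier) → Carrier
  sum2 n g = foldr _+_ 0# (map (λ j → g (2 ℕ.+ j)) (upTo (n ∸ 1)))

  aPoint : ℕ → Coords → Carrier
  aPoint r p with r
  ... | 2 = - (P 1 * P 4) + P 2 * P 2 + P 5 - P 6
    where P = at p
  ... | _ = negPow (r ∸ 1)
      ( P 1 * P (4 ℕ.* r ∸ 4) - P 2 * P (4 ℕ.* r ∸ 6) - P 2 * P (4 ℕ.* r ∸ 7)
      + P 3 * P (4 ℕ.* r ∸ 8) - P (4 ℕ.* r ∸ 3) + P (4 ℕ.* r ∸ 2)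
      + sum2 (r ∸ 2) (λ i → - (P (4 ℕ.* i ∸ 3) * P (4 ℕ.* (r ∸ i) ∸ 2))
                             + P (4 ℕ.* i ∸ 1) * P (4 ℕ.* (r ∸ i) ∸ 4)))
    where P = at p

  aLine : ℕ → Coords → Carrier
  aLine r l with r
  ... | 2 = - (L 1 * L 3) + L 2 * L 2 - L 5 + L 6
    where L = at l
  ... | _ = negPow (r ∸ 1)
      ( L 1 * L (4 ℕ.* r ∸ 5) - L 2 * L (4 ℕ.* r ∸ 6) - L 2 * L (4 ℕ.* r ∸ 7)
      + L 3 * L (4 ℕ.* r ∸ 8) + L (4 ℕ.* r ∸ 3) - L (4 ℕ.* r ∸ 2)
      + sum2 (r ∸ 2) (λ i → - (L (4 ℕ.* i ∸ 3) * L (4 ℕ.* (r ∸ i) ∸ 2))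
                             + L (4 ℕ.* i ∸ 1) * L (4 ℕ.* (r ∸ i) ∸ 4)))
    where L = at l

  a : ℕ → Vertex → Carrier
  a r (inj₁ p) = aPoint r p
  a r (inj₂ l) = aLine r l

  t : ℕ
  t = (k ℕ.+ 2) / 4

  SameInvariant : Vertex → Vertex → Set ℓ
  SameInvariant u v = ∀ r → 2 ≤ r → r ≤ t → a r u ≈ a r v

-- With x = l₁ and y = p₁, incidence expresses every
-- line coordinate through the point: l₂ = y x − p₂, l₃ = y l₂ − p₃, and for i ≥ 4,
-- l_i = p_{i−2} x − p_i if i ≡ 0, 1 (mod 4) and l_i = y l_{i−2} − p_i if i ≡ 2, 3.
-- After this substitution the (2+j)-th summand of a_{3+m}(l) exceeds that of a_{3+m}(p)
-- by x (c_j − c_{j+1}) with c_j = p_{4j+3} p_{4(m−j)+2}; the sums therefore differ by the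
-- telescoped x (c_0 − c_m), which cancels against the rest of the bracket by a polynomial
-- identity. The bound r ≤ t = ⌊(k+2)/4⌋ keeps every index that occurs at most k.
module Submission where

open import Defs
open import Level using (Level; 0ℓ)
open import Data.Nat using (ℕ; _≤_)
open import Data.Nat as ℕ using (zero; suc; _<_; _∸_; _%_)
open import Data.Bool using (T)
import Data.Nat.Properties as ℕₚ
open import Data.Nat.DivMod using ([m+kn]%n≡m%n; m/n*n≤m)
open import Data.Nat.Divisibility using (_∣_; divides-refl; _∣0; m∣m*n; ∣m∣n⇒∣m+n; ∣-refl)
open import Data.Fin using (toℕ)
open import Data.Fin.Properties using (toℕ<n)
open import Data.Product using (_,_) renaming (_×_ to _⊗_)
open import Data.Sum using (_⊎_; inj₁; inj₂)
open import Data.Maybe using (Maybe; just; nothing)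
open import Data.List using (foldr; map; applyUpTo)
open import Function using (_∘_)
open import Relation.Nullary using (yes; no)
open import Relation.Binary.PropositionalEquality as ≡ using (_≡_)
open import Relation.Binary.Construct.Closure.ReflexiveTransitive using (fold)
open import Algebra.Bundles using (RawRing; Ring; CommutativeRing)
open import Algebra.Solver.Ring.AlmostCommutativeRing
  using (fromCommutativeRing; _-Raw-AlmostCommutative⟶_)

-- Algebra.Solver.Ring needs a coefficient ring mapping into R; for an arbitrary
-- commutative ring we take pairs (a , b) of naturals, read as a · 1 − b · 1.
module FormalDifferenceSolver {c ℓ : Level} (R : CommutativeRing c ℓ) where
  open CommutativeRing R
  open import Algebra.Properties.Ring ring using (x[y-z]≈xy-xz; [y-z]x≈yx-zx)
  open import Algebra.Properties.AbelianGroup +-abelianGroup using (⁻¹-∙-comm; ⁻¹-anti-homo‿-)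
  open import Algebra.Properties.Group +-group using (ε⁻¹≈ε)
  open import Algebra.Properties.CommutativeSemigroup +-commutativeSemigroup using (interchange)
  open import Algebra.Properties.Semiring.Mult semiring using (_×_; ×-homo-+; ×1-homo-*; ×-homo-1)
  open import Relation.Binary.Reasoning.Setoid setoid

  ℕ²-rawRing : RawRing 0ℓ 0ℓ
  ℕ²-rawRing = record
    { Carrier = ℕ ⊗ ℕ
    ; _≈_     = _≡_
    ; _+_     = λ (a , b) (a′ , b′) → (a ℕ.+ a′ , b ℕ.+ b′)
    ; _*_     = λ (a , b) (a′ , b′) → (a ℕ.* a′ ℕ.+ b ℕ.* b′ , a ℕ.* b′ ℕ.+ b ℕ.* a′)
    ; -_      = λ (a , b) → (b , a)
    ; 0#      = (0 , 0)
    ; 1#      = (1 , 0)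
    }

  ⟦_⟧ : ℕ ⊗ ℕ → Carrier
  ⟦ a , b ⟧ = a × 1# - b × 1#

  [w+x]-[y+z]≈[w-y]+[x-z] : ∀ w x y z → (w + x) - (y + z) ≈ (w - y) + (x - z)
  [w+x]-[y+z]≈[w-y]+[x-z] w x y z = begin
    (w + x) - (y + z)     ≈⟨ +-congˡ (⁻¹-∙-comm y z) ⟨
    (w + x) + (- y + - z) ≈⟨ interchange w x (- y) (- z) ⟩
    (w - y) + (x - z)     ∎

  [x+z]-[y+z]≈x-y : ∀ x y z → (x + z) - (y + z) ≈ x - y
  [x+z]-[y+z]≈x-y x y z = begin
    (x + z) - (y + z)   ≈⟨ [w+x]-[y+z]≈[w-y]+[x-z] x z y z ⟩
    (x - y) + (z - z)   ≈⟨ +-congˡ (-‿inverseʳ z) ⟩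
    (x - y) + 0#        ≈⟨ +-identityʳ (x - y) ⟩
    x - y               ∎

  [wy+xz]-[wz+xy]≈[w-x][y-z] : ∀ w x y z → (w * y + x * z) - (w * z + x * y) ≈ (w - x) * (y - z)
  [wy+xz]-[wz+xy]≈[w-x][y-z] w x y z = begin
    (w * y + x * z) - (w * z + x * y)   ≈⟨ +-congˡ (-‿cong (+-comm (w * z) (x * y))) ⟩
    (w * y + x * z) - (x * y + w * z)   ≈⟨ [w+x]-[y+z]≈[w-y]+[x-z] (w * y) (x * z) (x * y) (w * z) ⟩
    (w * y - x * y) + (x * z - w * z)   ≈⟨ +-congˡ (⁻¹-anti-homo‿- (w * z) (x * z)) ⟨
    (w * y - x * y) - (w * z - x * z)   ≈⟨ +-cong ([y-z]x≈yx-zx y w x) (-‿cong ([y-z]x≈yx-zx z w x)) ⟨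
    (w - x) * y - (w - x) * z           ≈⟨ x[y-z]≈xy-xz (w - x) y z ⟨
    (w - x) * (y - z)                   ∎

  homomorphism : ℕ²-rawRing -Raw-AlmostCommutative⟶ fromCommutativeRing R
  homomorphism = record
    { ⟦_⟧    = ⟦_⟧
    ; +-homo = λ (a , b) (a′ , b′) →
        trans (+-cong (×-homo-+ 1# a a′) (-‿cong (×-homo-+ 1# b b′)))
              ([w+x]-[y+z]≈[w-y]+[x-z] _ _ _ _)
    ; *-homo = λ (a , b) (a′ , b′) →
        trans (+-cong (×-homo-+* a a′ b b′) (-‿cong (×-homo-+* a b′ b a′)))
              ([wy+xz]-[wz+xy]≈[w-x][y-z] _ _ _ _)
    ; -‿homo = λ (a , b) → sym (⁻¹-anti-homo‿- (a × 1#) (b × 1#))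
    ; 0-homo = -‿inverseʳ 0#
    ; 1-homo = trans (+-cong (×-homo-1 1#) ε⁻¹≈ε) (+-identityʳ 1#)
    }
    where
    ×-homo-+* : ∀ a a′ b b′ → (a ℕ.* a′ ℕ.+ b ℕ.* b′) × 1# ≈ (a × 1#) * (a′ × 1#) + (b × 1#) * (b′ × 1#)
    ×-homo-+* a a′ b b′ = trans (×-homo-+ 1# (a ℕ.* a′) (b ℕ.* b′)) (+-cong (×1-homo-* a a′) (×1-homo-* b b′))

  ⟦⟧-≟ : ∀ x y → Maybe (⟦ x ⟧ ≈ ⟦ y ⟧)
  ⟦⟧-≟ (a , b) (a′ , b′) with a ℕ.+ b′ ℕ.≟ a′ ℕ.+ b
  ... | no _ = nothing
  ... | yes a+b′≡a′+b = just (begin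
    a × 1# - b × 1#                          ≈⟨ [x+z]-[y+z]≈x-y _ _ (b′ × 1#) ⟨
    (a × 1# + b′ × 1#) - (b × 1# + b′ × 1#)  ≈⟨ +-congʳ (×-homo-+ 1# a b′) ⟨
    (a ℕ.+ b′) × 1# - (b × 1# + b′ × 1#)     ≡⟨ ≡.cong (λ n → n × 1# - (b × 1# + b′ × 1#)) a+b′≡a′+b ⟩
    (a′ ℕ.+ b) × 1# - (b × 1# + b′ × 1#)     ≈⟨ +-cong (×-homo-+ 1# a′ b) (-‿cong (+-comm _ _)) ⟩
    (a′ × 1# + b × 1#) - (b′ × 1# + b × 1#)  ≈⟨ [x+z]-[y+z]≈x-y _ _ (b × 1#) ⟩
    a′ × 1# - b′ × 1#                        ∎)

  open import Algebra.Solver.Ring ℕ²-rawRing (fromCommutativeRing R) homomorphism ⟦⟧-≟ public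
    using (solve; _:=_; _:+_; _:*_; _:-_; :-_)

module RingSum {c ℓ : Level} (R : Ring c ℓ) where
  open Ring R
  open import Algebra.Properties.Semiring.Sum semiring using (sum-syntax)
  open import Relation.Binary.Reasoning.Setoid setoid

  foldr-map-applyUpTo≡∑ : ∀ (g : ℕ → Carrier) (f : ℕ → ℕ) n →
    foldr _+_ 0# (map g (applyUpTo f n)) ≡ ∑[ i < n ] g (f (toℕ i))
  foldr-map-applyUpTo≡∑ g f zero    = ≡.refl
  foldr-map-applyUpTo≡∑ g f (suc n) = ≡.cong (g (f 0) +_) (foldr-map-applyUpTo≡∑ g (f ∘ suc) n)

  [x-y]+[y-z]≈x-z : ∀ x y z → (x - y) + (y - z) ≈ x - z
  [x-y]+[y-z]≈x-z x y z = begin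
    (x - y) + (y - z)   ≈⟨ +-assoc x (- y) (y - z) ⟩
    x + (- y + (y - z)) ≈⟨ +-congˡ (+-assoc (- y) y (- z)) ⟨
    x + ((- y + y) - z) ≈⟨ +-congˡ (+-congʳ (-‿inverseˡ y)) ⟩
    x + (0# - z)        ≈⟨ +-congˡ (+-identityˡ (- z)) ⟩
    x - z               ∎

  sum-telescope : ∀ n (h : ℕ → Carrier) → ∑[ i < n ] (h (toℕ i) - h (suc (toℕ i))) ≈ h 0 - h n
  sum-telescope zero    h = sym (-‿inverseʳ (h 0))
  sum-telescope (suc n) h = trans (+-congˡ (sum-telescope n (h ∘ suc))) ([x-y]+[y-z]≈x-z (h 0) (h 1) (h (suc n)))

module Invariance {c ℓ : Level} {q : ℕ} (F : FiniteField c ℓ q) (k : ℕ) where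
  open FiniteField F
  open DGraph F k
  open FormalDifferenceSolver commRing using (solve; _:=_; _:+_; _:*_; _:-_; :-_)
  open RingSum ring using (foldr-map-applyUpTo≡∑; sum-telescope)
  open import Algebra.Properties.Semiring.Sum semiring using (sum-syntax; sum-cong-≋; ∑-distrib-+; *-distribˡ-sum)
  open import Relation.Binary.Reasoning.Setoid setoid

  negPow-cong : ∀ n {x y} → x ≈ y → negPow n x ≈ negPow n y
  negPow-cong zero    x≈y = x≈y
  negPow-cong (suc n) x≈y = -‿cong (negPow-cong n x≈y)

  -- The bracket of a_r (r ≥ 3) as a function of n = 4r, and its i-th summand as a
  -- function of a = 4i and b = 4(r − i).
  pointBracket lineBracket : (ℕ → Carrier) → ℕ → Carrier → Carrier
  pointBracket X n S = X 1 * X (n ∸ 4) - X 2 * X (n ∸ 6) - X 2 * X (n ∸ 7) + X 3 * X (n ∸ 8) - X (n ∸ 3) + X (n ∸ 2) + S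
  lineBracket  X n S = X 1 * X (n ∸ 5) - X 2 * X (n ∸ 6) - X 2 * X (n ∸ 7) + X 3 * X (n ∸ 8) + X (n ∸ 3) - X (n ∸ 2) + S

  summand : (ℕ → Carrier) → ℕ → ℕ → Carrier
  summand X a b = - (X (a ∸ 3) * X (b ∸ 2)) + X (a ∸ 1) * X (b ∸ 4)

  aSum : (ℕ → Carrier) → ℕ → Carrier
  aSum X r = sum2 (r ∸ 2) (λ i → summand X (4 ℕ.* i) (4 ℕ.* (r ∸ i)))

  aSummand : (ℕ → Carrier) → ℕ → ℕ → Carrier
  aSummand X m j = summand X (4 ℕ.* (2 ℕ.+ j)) (4 ℕ.* ((3 ℕ.+ m) ∸ (2 ℕ.+ j)))

  aSummand-reindex : ∀ X {m j} → j < m →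
    aSummand X m j ≡ summand X (8 ℕ.+ 4 ℕ.* j) (8 ℕ.+ 4 ℕ.* (m ∸ suc j))
  aSummand-reindex X {m} {j} j<m = ≡.cong₂ (summand X) (ℕₚ.*-distribˡ-+ 4 2 j)
    (≡.trans (≡.cong (4 ℕ.*_) (ℕₚ.+-∸-assoc 2 j<m)) (ℕₚ.*-distribˡ-+ 4 2 (m ∸ suc j)))

  2≤2+n : ∀ {n} → 2 ≤ 2 ℕ.+ n
  2≤2+n = ℕ.s≤s (ℕ.s≤s ℕ.z≤n)

  4[3+m]≡12+4m : ∀ m → 4 ℕ.* (3 ℕ.+ m) ≡ 12 ℕ.+ 4 ℕ.* m
  4[3+m]≡12+4m = ℕₚ.*-distribˡ-+ 4 3

  aPoint-3+m : ∀ m p → aPoint (3 ℕ.+ m) p ≡ negPow (2 ℕ.+ m) (pointBracket (at p) (12 ℕ.+ 4 ℕ.* m) (aSum (at p) (3 ℕ.+ m)))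
  aPoint-3+m m p = ≡.cong (λ n → negPow (2 ℕ.+ m) (pointBracket (at p) n (aSum (at p) (3 ℕ.+ m)))) (4[3+m]≡12+4m m)

  aLine-3+m : ∀ m l → aLine (3 ℕ.+ m) l ≡ negPow (2 ℕ.+ m) (lineBracket (at l) (12 ℕ.+ 4 ℕ.* m) (aSum (at l) (3 ℕ.+ m)))
  aLine-3+m m l = ≡.cong (λ n → negPow (2 ℕ.+ m) (lineBracket (at l) n (aSum (at l) (3 ℕ.+ m)))) (4[3+m]≡12+4m m)

  4r≤2+k : ∀ {r} → r ≤ t → 4 ℕ.* r ≤ 2 ℕ.+ k
  4r≤2+k {r} r≤t = ≡.subst₂ _≤_ (ℕₚ.*-comm r 4) (ℕₚ.+-comm k 2)
    (ℕₚ.≤-trans (ℕₚ.*-monoˡ-≤ 4 r≤t) (m/n*n≤m (k ℕ.+ 2) 4))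

  index-bound : ∀ {c n m} → c ≤ 10 → n ≤ m → 10 ℕ.+ 4 ℕ.* m ≤ k → c ℕ.+ 4 ℕ.* n ≤ k
  index-bound c≤10 n≤m = ℕₚ.≤-trans (ℕₚ.+-mono-≤ c≤10 (ℕₚ.*-monoʳ-≤ 4 n≤m))

  [c+n]%4≡c%4 : ∀ c {n} → 4 ∣ n → (c ℕ.+ n) % 4 ≡ c % 4
  [c+n]%4≡c%4 c (divides-refl j) = [m+kn]%n≡m%n c j 4

  f[4+m]≡p[2+m]*l[1] : ∀ p l m → m % 4 ≡ 0 ⊎ m % 4 ≡ 1 → f p l (4 ℕ.+ m) ≡ at p (2 ℕ.+ m) * at l 1
  f[4+m]≡p[2+m]*l[1] p l m (inj₁ m%4≡0) rewrite m%4≡0 = ≡.refl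
  f[4+m]≡p[2+m]*l[1] p l m (inj₂ m%4≡1) rewrite m%4≡1 = ≡.refl

  f[4+m]≡p[1]*l[2+m] : ∀ p l m → m % 4 ≡ 2 ⊎ m % 4 ≡ 3 → f p l (4 ℕ.+ m) ≡ at p 1 * at l (2 ℕ.+ m)
  f[4+m]≡p[1]*l[2+m] p l m (inj₁ m%4≡2) rewrite m%4≡2 = ≡.refl
  f[4+m]≡p[1]*l[2+m] p l m (inj₂ m%4≡3) rewrite m%4≡3 = ≡.refl

  module IncidentPair {p l : Coords} (p∼l : Incident p l) where
    P L : ℕ → Carrier
    P = at p
    L = at l

    x y : Carrier
    x = L 1
    y = P 1

    line-coordinate : ∀ {i} → 2 ≤ i → i ≤ k → L i ≈ f p l i - P i
    line-coordinate {i} 2≤i i≤k =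
      trans (solve 2 (λ a b → b := (a :+ b) :- a) refl (P i) (L i)) (+-congʳ (p∼l i 2≤i i≤k))

    line-2 : 2 ≤ k → L 2 ≈ y * x - P 2
    line-2 = line-coordinate 2≤2+n

    line-3 : 3 ≤ k → L 3 ≈ y * (y * x - P 2) - P 3
    line-3 3≤k = trans (line-coordinate 2≤2+n 3≤k) (+-congʳ (*-congˡ (line-2 (ℕₚ.m+n≤o⇒n≤o 1 3≤k))))

    line-4+n : ∀ {n} → 4 ∣ n → 4 ℕ.+ n ≤ k → L (4 ℕ.+ n) ≈ P (2 ℕ.+ n) * x - P (4 ℕ.+ n)
    line-4+n 4∣n b = trans (line-coordinate 2≤2+n b) (+-congʳ (reflexive (f[4+m]≡p[2+m]*l[1] p l _ (inj₁ ([c+n]%4≡c%4 0 4∣n)))))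

    line-5+n : ∀ {n} → 4 ∣ n → 5 ℕ.+ n ≤ k → L (5 ℕ.+ n) ≈ P (3 ℕ.+ n) * x - P (5 ℕ.+ n)
    line-5+n 4∣n b = trans (line-coordinate 2≤2+n b) (+-congʳ (reflexive (f[4+m]≡p[2+m]*l[1] p l _ (inj₂ ([c+n]%4≡c%4 1 4∣n)))))

    line-6+n : ∀ {n} → 4 ∣ n → 6 ℕ.+ n ≤ k →
      L (6 ℕ.+ n) ≈ y * (P (2 ℕ.+ n) * x - P (4 ℕ.+ n)) - P (6 ℕ.+ n)
    line-6+n 4∣n b = trans (line-coordinate 2≤2+n b) (+-congʳ (trans
      (reflexive (f[4+m]≡p[1]*l[2+m] p l _ (inj₁ ([c+n]%4≡c%4 2 4∣n))))
      (*-congˡ (line-4+n 4∣n (ℕₚ.m+n≤o⇒n≤o 2 b)))))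

    line-7+n : ∀ {n} → 4 ∣ n → 7 ℕ.+ n ≤ k →
      L (7 ℕ.+ n) ≈ y * (P (3 ℕ.+ n) * x - P (5 ℕ.+ n)) - P (7 ℕ.+ n)
    line-7+n 4∣n b = trans (line-coordinate 2≤2+n b) (+-congʳ (trans
      (reflexive (f[4+m]≡p[1]*l[2+m] p l _ (inj₂ ([c+n]%4≡c%4 3 4∣n))))
      (*-congˡ (line-5+n 4∣n (ℕₚ.m+n≤o⇒n≤o 2 b)))))

    a₂-incident : 6 ≤ k → aPoint 2 p ≈ aLine 2 l
    a₂-incident 6≤k = sym (begin
      - (x * L 3) + L 2 * L 2 - L 5 + L 6
        ≈⟨ +-cong (+-cong (+-cong (-‿cong (*-congˡ (line-3 (ℕₚ.m+n≤o⇒n≤o 3 6≤k))))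
                                  (*-cong (line-2 (ℕₚ.m+n≤o⇒n≤o 4 6≤k)) (line-2 (ℕₚ.m+n≤o⇒n≤o 4 6≤k))))
                          (-‿cong (line-5+n (4 ∣0) (ℕₚ.m+n≤o⇒n≤o 1 6≤k))))
                  (line-6+n (4 ∣0) 6≤k) ⟩
      - (x * (y * (y * x - P 2) - P 3)) + (y * x - P 2) * (y * x - P 2) - (P 3 * x - P 5)
        + (y * (P 2 * x - P 4) - P 6)
        ≈⟨ solve 7 (λ x y p₂ p₃ p₄ p₅ p₆ →
             :- (x :* (y :* (y :* x :- p₂) :- p₃)) :+ (y :* x :- p₂) :* (y :* x :- p₂) :- (p₃ :* x :- p₅)
               :+ (y :* (p₂ :* x :- p₄) :- p₆)
             := :- (y :* p₄) :+ p₂ :* p₂ :+ p₅ :- p₆) refl x y (P 2) (P 3) (P 4) (P 5) (P 6) ⟩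
      - (y * P 4) + P 2 * P 2 + P 5 - P 6 ∎)

    summand-incident : ∀ j w → 7 ℕ.+ 4 ℕ.* j ≤ k → 6 ℕ.+ 4 ℕ.* w ≤ k →
      summand L (8 ℕ.+ 4 ℕ.* j) (8 ℕ.+ 4 ℕ.* w)
        ≈ summand P (8 ℕ.+ 4 ℕ.* j) (8 ℕ.+ 4 ℕ.* w)
          + x * (P (3 ℕ.+ 4 ℕ.* j) * P (6 ℕ.+ 4 ℕ.* w) - P (7 ℕ.+ 4 ℕ.* j) * P (2 ℕ.+ 4 ℕ.* w))
    summand-incident j w bj bw = trans
      (+-cong (-‿cong (*-cong (line-5+n (m∣m*n j) (ℕₚ.m+n≤o⇒n≤o 2 bj)) (line-6+n (m∣m*n w) bw)))
              (*-cong (line-7+n (m∣m*n j) bj) (line-4+n (m∣m*n w) (ℕₚ.m+n≤o⇒n≤o 2 bw))))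
      (solve 8 (λ x y a₃ a₅ a₇ b₂ b₄ b₆ →
          :- ((a₃ :* x :- a₅) :* (y :* (b₂ :* x :- b₄) :- b₆)) :+ (y :* (a₃ :* x :- a₅) :- a₇) :* (b₂ :* x :- b₄)
          := (:- (a₅ :* b₆) :+ a₇ :* b₄) :+ x :* (a₃ :* b₆ :- a₇ :* b₂)) refl
        x y (P (3 ℕ.+ 4 ℕ.* j)) (P (5 ℕ.+ 4 ℕ.* j)) (P (7 ℕ.+ 4 ℕ.* j))
            (P (2 ℕ.+ 4 ℕ.* w)) (P (4 ℕ.+ 4 ℕ.* w)) (P (6 ℕ.+ 4 ℕ.* w)))

    corner : ℕ → ℕ → Carrier
    corner m j = P (3 ℕ.+ 4 ℕ.* j) * P (2 ℕ.+ 4 ℕ.* (m ∸ j))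

    aSummand-incident : ∀ m j → j < m → 10 ℕ.+ 4 ℕ.* m ≤ k →
      aSummand L m j ≈ aSummand P m j + x * (corner m j - corner m (suc j))
    aSummand-incident m j j<m b = begin
      aSummand L m j
        ≡⟨ aSummand-reindex L j<m ⟩
      summand L (8 ℕ.+ 4 ℕ.* j) (8 ℕ.+ 4 ℕ.* w)
        ≈⟨ summand-incident j w (index-bound (ℕₚ.≤ᵇ⇒≤ 7 10 _) (ℕₚ.<⇒≤ j<m) b)
                                (index-bound (ℕₚ.≤ᵇ⇒≤ 6 10 _) (ℕₚ.m∸n≤m m (suc j)) b) ⟩
      summand P (8 ℕ.+ 4 ℕ.* j) (8 ℕ.+ 4 ℕ.* w)
        + x * (P (3 ℕ.+ 4 ℕ.* j) * P (6 ℕ.+ 4 ℕ.* w) - P (7 ℕ.+ 4 ℕ.* j) * P (2 ℕ.+ 4 ℕ.* w))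
        ≡⟨ ≡.cong₂ (λ s d → s + x * d) (≡.sym (aSummand-reindex P j<m))
             (≡.cong₂ (λ i i′ → P (3 ℕ.+ 4 ℕ.* j) * P i - P i′ * P (2 ℕ.+ 4 ℕ.* w))
                (≡.sym 2+4[m∸j]≡6+4w) (≡.sym (≡.cong (3 ℕ.+_) (ℕₚ.*-suc 4 j)))) ⟩
      aSummand P m j + x * (corner m j - corner m (suc j)) ∎
      where
      w : ℕ
      w = m ∸ suc j

      2+4[m∸j]≡6+4w : 2 ℕ.+ 4 ℕ.* (m ∸ j) ≡ 6 ℕ.+ 4 ℕ.* w
      2+4[m∸j]≡6+4w = ≡.trans (≡.cong (λ i → 2 ℕ.+ 4 ℕ.* i) (ℕₚ.+-∸-assoc 1 j<m)) (≡.cong (2 ℕ.+_) (ℕₚ.*-suc 4 w))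

    aSum-incident : ∀ m → 10 ℕ.+ 4 ℕ.* m ≤ k →
      aSum L (3 ℕ.+ m) ≈ aSum P (3 ℕ.+ m) + x * (P 3 * P (2 ℕ.+ 4 ℕ.* m) - P (3 ℕ.+ 4 ℕ.* m) * P 2)
    aSum-incident m b = begin
      aSum L (3 ℕ.+ m)
        ≡⟨ foldr-map-applyUpTo≡∑ (aSummand L m) (λ j → j) m ⟩
      ∑[ j < m ] aSummand L m (toℕ j)
        ≈⟨ sum-cong-≋ (λ j → aSummand-incident m (toℕ j) (toℕ<n j) b) ⟩
      ∑[ j < m ] (aSummand P m (toℕ j) + x * Δ (toℕ j))
        ≈⟨ ∑-distrib-+ {m} (aSummand P m ∘ toℕ) (λ j → x * Δ (toℕ j)) ⟩
      ∑[ j < m ] aSummand P m (toℕ j) + ∑[ j < m ] (x * Δ (toℕ j))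
        ≈⟨ +-cong (reflexive (≡.sym (foldr-map-applyUpTo≡∑ (aSummand P m) (λ j → j) m)))
                  (sym (*-distribˡ-sum {m} x (Δ ∘ toℕ))) ⟩
      aSum P (3 ℕ.+ m) + x * ∑[ j < m ] Δ (toℕ j)
        ≈⟨ +-congˡ (*-congˡ (sum-telescope m (corner m))) ⟩
      aSum P (3 ℕ.+ m) + x * (corner m 0 - corner m m)
        ≡⟨ ≡.cong (λ i → aSum P (3 ℕ.+ m) + x * (corner m 0 - P (3 ℕ.+ 4 ℕ.* m) * P (2 ℕ.+ 4 ℕ.* i)))
                  (ℕₚ.n∸n≡0 m) ⟩
      aSum P (3 ℕ.+ m) + x * (P 3 * P (2 ℕ.+ 4 ℕ.* m) - P (3 ℕ.+ 4 ℕ.* m) * P 2) ∎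
      where
      Δ : ℕ → Carrier
      Δ j = corner m j - corner m (suc j)

    bracket-incident : ∀ m → 10 ℕ.+ 4 ℕ.* m ≤ k →
      lineBracket L (12 ℕ.+ 4 ℕ.* m) (aSum L (3 ℕ.+ m)) ≈ pointBracket P (12 ℕ.+ 4 ℕ.* m) (aSum P (3 ℕ.+ m))
    bracket-incident m b = trans
      (+-cong (+-cong (+-cong (+-cong (+-cong (+-cong
        (*-congˡ (line-7+n 4∣4m (bound 7)))
        (-‿cong (*-cong (line-2 2≤k) (line-6+n 4∣4m (bound 6)))))
        (-‿cong (*-cong (line-2 2≤k) (line-5+n 4∣4m (bound 5)))))
        (*-cong (line-3 3≤k) (line-4+n 4∣4m (bound 4))))
        (line-5+n 4∣4+4m (bound 9)))
        (-‿cong (line-6+n 4∣4+4m (bound 10))))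
        (aSum-incident m b))
      (solve 14 (λ x y p₂ p₃ q₂ q₃ q₄ q₅ q₆ q₇ q₈ q₉ q₁₀ s →
          x :* (y :* (q₃ :* x :- q₅) :- q₇) :- (y :* x :- p₂) :* (y :* (q₂ :* x :- q₄) :- q₆)
          :- (y :* x :- p₂) :* (q₃ :* x :- q₅) :+ (y :* (y :* x :- p₂) :- p₃) :* (q₂ :* x :- q₄)
          :+ (q₇ :* x :- q₉) :- (y :* (q₆ :* x :- q₈) :- q₁₀) :+ (s :+ x :* (p₃ :* q₂ :- q₃ :* p₂))
          := y :* q₈ :- p₂ :* q₆ :- p₂ :* q₅ :+ p₃ :* q₄ :- q₉ :+ q₁₀ :+ s) refl
        x y (P 2) (P 3) (Q 2) (Q 3) (Q 4) (Q 5) (Q 6) (Q 7) (Q 8) (Q 9) (Q 10) (aSum P (3 ℕ.+ m)))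
      where
      Q : ℕ → Carrier
      Q c = P (c ℕ.+ 4 ℕ.* m)

      bound : ∀ c → {T (c ℕ.≤ᵇ 10)} → c ℕ.+ 4 ℕ.* m ≤ k
      bound c {c≤10} = index-bound {n = m} (ℕₚ.≤ᵇ⇒≤ c 10 c≤10) ℕₚ.≤-refl b

      2≤k : 2 ≤ k
      2≤k = index-bound {m = m} (ℕₚ.≤ᵇ⇒≤ 2 10 _) ℕ.z≤n b

      3≤k : 3 ≤ k
      3≤k = index-bound {m = m} (ℕₚ.≤ᵇ⇒≤ 3 10 _) ℕ.z≤n b

      4∣4m : 4 ∣ 4 ℕ.* m
      4∣4m = m∣m*n m

      4∣4+4m : 4 ∣ 4 ℕ.+ 4 ℕ.* m
      4∣4+4m = ∣m∣n⇒∣m+n ∣-refl 4∣4m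

    a-incident : ∀ r → 2 ≤ r → r ≤ t → aPoint r p ≈ aLine r l
    a-incident 1 (ℕ.s≤s ()) _
    a-incident 2 _ r≤t = a₂-incident (ℕₚ.≤-pred (ℕₚ.≤-pred (4r≤2+k r≤t)))
    a-incident (suc (suc (suc m))) _ r≤t = begin
      aPoint (3 ℕ.+ m) p
        ≡⟨ aPoint-3+m m p ⟩
      negPow (2 ℕ.+ m) (pointBracket P (12 ℕ.+ 4 ℕ.* m) (aSum P (3 ℕ.+ m)))
        ≈⟨ negPow-cong (2 ℕ.+ m) (bracket-incident m 10+4m≤k) ⟨
      negPow (2 ℕ.+ m) (lineBracket L (12 ℕ.+ 4 ℕ.* m) (aSum L (3 ℕ.+ m)))
        ≡⟨ aLine-3+m m l ⟨
      aLine (3 ℕ.+ m) l ∎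
      where
      10+4m≤k : 10 ℕ.+ 4 ℕ.* m ≤ k
      10+4m≤k = ℕₚ.≤-pred (ℕₚ.≤-pred (≡.subst (_≤ 2 ℕ.+ k) (4[3+m]≡12+4m m) (4r≤2+k r≤t)))

  adjacent⇒sameInvariant : ∀ {u v} → Adj u v → SameInvariant u v
  adjacent⇒sameInvariant {inj₁ p} {inj₂ l} p∼l r 2≤r r≤t = IncidentPair.a-incident p∼l r 2≤r r≤t
  adjacent⇒sameInvariant {inj₂ l} {inj₁ p} p∼l r 2≤r r≤t = sym (IncidentPair.a-incident p∼l r 2≤r r≤t)
  adjacent⇒sameInvariant {inj₁ _} {inj₁ _} ()
  adjacent⇒sameInvariant {inj₂ _} {inj₂ _} ()

  sameComponent⇒sameInvariant : ∀ {u v} → SameComponent u v → SameInvariant u v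
  sameComponent⇒sameInvariant = fold SameInvariant
    (λ u∼w w≈v r 2≤r r≤t → trans (adjacent⇒sameInvariant u∼w r 2≤r r≤t) (w≈v r 2≤r r≤t))
    (λ _ _ _ → refl)

corollary6p20 : ∀ {c ℓ : Level} (k q : ℕ) → 6 ≤ k → IsPrimePower q →
    (F : FiniteField c ℓ q) → (u v : DGraph.Vertex F k) →
    DGraph.SameComponent F k u v → DGraph.SameInvariant F k u v
corollary6p20 k q _ _ F u v = Invariance.sameComponent⇒sameInvariant F k
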